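{- For all integers $h\ge 2$ and $k\ge 2$, every deterministic thrifty $k$-way branching program solving $BT^h_2(k)$ has at least $\sum_{l=2}^{h}k^l$ states.
   Context: Let $[k]=\{1,\dots,k\}$. $T^h_2$ is the balanced rooted binary tree with $h$ levels (height counts levels), nodes numbered heap-style: root $1$, children of node $i$ are $2i$ and $2i+1$. An instance with parameter $k$ assigns to each internal node $i$ a function $f_i:[k]^2\to[k]$ (given by its $k^2$ values) and to each leaf an element of $[k]$. Values: $v_i$ is the leaf label for a leaf, and $v_i=f_i(v_{2i},v_{2i+1})$ for an internal node. $BT^h_2(k)$ is the problem of deciding whether $v_1=1$. The $k$-ary input variables are $f_i(a,b)$ for internal $i$ and $a,b\in[k]$, plus one variable per leaf. A deterministic $k$-way branching program computing $g:[k]^m\to R$ is a directed rooted multigraph of states; each nonfinal state is labelled by a variable index in $[m]$ and has exactly $k$ outedges labelled $1,\dots,k$; there are $|R|$ final sink states labelled by elements of $R$; on input $x$ the computation starts at the root and from a state labelled $j$ follows the edge labelled $x_j$; it must reach the final state labelled $g(x)$. Such a program solving $BT^h_2(k)$ is thrifty if, on every input, every query to a variable $f_i(a,b)$ of an internal node $i$ made during the computation satisfies $(a,b)=(v_{2i},v_{2i+1})$. -}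

module Defs where

open import Data.Nat using (ℕ; zero; suc; _+_; _*_; _∸_; _^_; _≤_; _<_; _≤?_; _<?_; _≡ᵇ_)
open import Data.Fin using (Fin; toℕ)
open import Data.Bool using (Bool; true; false)
open import Data.Maybe using (Maybe; just; nothing)
open import Data.Product using (_×_; _,_; ∃)
open import Data.Sum using (_⊎_; inj₁; inj₂)
open import Relation.Nullary using (Dec; yes; no)
open import Relation.Nullary.Decidable using (_×-dec_)
open import Relation.Binary.PropositionalEquality using (_≡_)

-- Convention: the set [k] = {1,…,k} is represented by Fin k, the element
-- j ∈ [k] corresponding to the Fin element with toℕ = j - 1.

-- The tree T^h_2 with heap numbering (nodes 1 … 2^h - 1)

Internal : ℕ → ℕ → Set
Internal h i = (1 ≤ i) × (i < 2 ^ (h ∸ 1))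

Leaf : ℕ → ℕ → Set
Leaf h i = (2 ^ (h ∸ 1) ≤ i) × (i < 2 ^ h)

internal? : ∀ h i → Dec (Internal h i)
internal? h i = (1 ≤? i) ×-dec (i <? 2 ^ (h ∸ 1))

leaf? : ∀ h i → Dec (Leaf h i)
leaf? h i = (2 ^ (h ∸ 1) ≤? i) ×-dec (i <? 2 ^ h)

data Var (h k : ℕ) : Set where
  fvar : (i : ℕ) → Internal h i → Fin k → Fin k → Var h k
  lvar : (i : ℕ) → Leaf h i → Var h k

Input : ℕ → ℕ → Set
Input h k = Var h k → Fin k

-- Value of node i, computed with fuel; nothing only for invalid nodes
-- or insufficient fuel.
valF : ∀ {h k} → Input h k → ℕ → ℕ → Maybe (Fin k)
valF x zero i = nothing
valF {h} x (suc n) i with leaf? h i | internal? h i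
... | yes p | _ = just (x (lvar i p))
... | no _ | no _ = nothing
... | no _ | yes q with valF x n (2 * i) | valF x n (2 * i + 1)
...   | just a | just b = just (x (fvar i q a b))
...   | _ | _ = nothing

-- v_i (fuel h suffices for every node of T^h_2)
nodeVal : ∀ {h k} → Input h k → ℕ → Maybe (Fin k)
nodeVal {h} x i = valF x h i

-- BT^h_2(k): is v_1 = 1 (i.e. the first element of [k])?
BT : (h k : ℕ) → Input h k → Bool
BT h k x with nodeVal x 1
... | just v = toℕ v ≡ᵇ 0
... | nothing = false

record BP (V : Set) (k : ℕ) : Set where
  field
    size  : ℕ
    root  : Fin size
    node  : Fin size → (V × (Fin k → Fin size)) ⊎ Bool
    -- exactly |R| final states, one for each output label
    final-exists : ∀ (b : Bool) → ∃ λ s → node s ≡ inj₂ b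
    final-unique : ∀ (b : Bool) (s t : Fin size) →
                   node s ≡ inj₂ b → node t ≡ inj₂ b → s ≡ t

module _ {V : Set} {k : ℕ} (P : BP V k) where
  open BP P

  step : (V → Fin k) → Fin size → Fin size
  step x s with node s
  ... | inj₁ (j , next) = next (x j)
  ... | inj₂ _ = s

  run : (V → Fin k) → ℕ → Fin size
  run x zero = root
  run x (suc t) = step x (run x t)

  Computes : ((V → Fin k) → Bool) → Set
  Computes g = ∀ x → ∃ λ t → node (run x t) ≡ inj₂ (g x)

Thrifty : (h k : ℕ) → BP (Var h k) k → Set
Thrifty h k P = ∀ (x : Input h k) (t : ℕ) (i : ℕ) (q : Internal h i)
  (a b : Fin k) (next : Fin k → Fin (BP.size P)) →
  BP.node P (run P x t) ≡ inj₁ (fvar i q a b , next) →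
  (nodeVal x (2 * i) ≡ just a) × (nodeVal x (2 * i + 1) ≡ just b)

powSum : ℕ → ℕ → ℕ
powSum k zero = 0
powSum k (suc zero) = 0
powSum k (suc (suc n)) = powSum k (suc n) + k ^ (suc (suc n))

module Submission where

-- We run the program only on node labellings V (each internal node gets
-- the constant function with its label), so a thrifty query f_i(a,b)
-- certifies the labels a, b of the children of i.  A state querying a node
-- at depth d has level d + 2; the levels are disjoint, and we show that each
-- level l ≤ h has at least k ^ l states.  By the pebbling lemma (`critical`,
-- `pebbled`) every V has a time τ at which a node at depth d is queried while
-- d + 2 distinct nodes are pending, i.e. will be certified by a query of
-- their parent before being queried themselves.  A decoder replaying the
-- program from the state at τ learns those labels for free, so V is
-- determined by that state and the N ∸ (d + 2) labels it reads
-- (N = 2 ^ h ∸ 1), and counting words gives the level bound.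

open import Defs
open import Data.Nat using (ℕ; zero; suc; _+_; _*_; _∸_; _^_; _≤_; _<_; _≤?_; _<?_; _≟_; _≡ᵇ_; _⊔_; ⌊_/2⌋; z≤n; s≤s; >-nonZero)
open import Data.Nat.Properties
open import Data.Nat.Logarithm using (⌊log₂_⌋; ⌊log₂⌋-mono-≤; ⌊log₂⌊n/2⌋⌋≡⌊log₂n⌋∸1; ⌊log₂[2*b]⌋≡1+⌊log₂b⌋)
open import Data.Bool using (Bool; true; false; not)
open import Data.Bool.Properties using (not-¬)
open import Data.Fin using (Fin; toℕ; fromℕ<) renaming (zero to fzero; suc to fsuc)
open import Data.Fin.Properties using (injective⇒≤; *↔×; toℕ-fromℕ<; toℕ<n)
open import Data.List using (List; []; _∷_; _++_; length; map; lookup; filter; allFin; applyUpTo)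
open import Data.List.Properties using (∷-injectiveˡ; ∷-injectiveʳ; length-++; length-map; map-++; ++-assoc; ++-identityʳ; length-tabulate)
open import Data.List.Membership.Propositional using (_∈_; _∉_; find)
open import Data.List.Membership.Propositional.Properties using (∈-++⁻; ∈-++⁺ˡ; ∈-++⁺ʳ; ∈-allFin; ∈-filter⁺; ∈-lookup; ∈-map⁻; ∈-applyUpTo⁺)
open import Data.List.Relation.Unary.Any using (Any; here; there; index; any?)
open import Data.List.Relation.Unary.Any.Properties using (lookup-index) renaming (++⁺ˡ to Any-++⁺ˡ)
open import Data.List.Relation.Unary.AllPairs using ([]; _∷_)
open import Data.List.Relation.Unary.Unique.Propositional using (Unique)
open import Data.List.Relation.Unary.Unique.Propositional.Properties using () renaming (map⁺ to Unique-map⁺; ++⁺ to Unique-++⁺)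
open import Data.List.Relation.Unary.All using (All; []; _∷_) renaming (lookup to all-lookup; map to all-map)
open import Data.List.Relation.Unary.All.Properties using (++⁺) renaming (map⁺ to All-map⁺; applyUpTo⁺₁ to All-applyUpTo⁺)
open import Data.Maybe using (Maybe; just; nothing; fromMaybe)
open import Data.Maybe.Properties using (just-injective)
open import Data.Product using (_×_; _,_; ∃; proj₁; proj₂; map₁)
open import Data.Sum using (_⊎_; inj₁; inj₂)
open import Data.Sum.Properties using (inj₂-injective)
open import Data.Vec using (Vec; []; _∷_; tabulate) renaming (lookup to vlookup)
open import Data.Vec.Properties using (tabulate∘lookup; tabulate-cong)
open import Data.Vec.Recursive using (Fin[m^n]↔Fin[m]^n)
open import Data.Vec.Recursive.Properties using (↔Vec)
open import Data.Empty using (⊥; ⊥-elim)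
open import Function using (_∘_; id; Injective; case_of_)
open import Function.Bundles using (Inverse; _↔_)
open import Function.Properties.Inverse using (↔-trans)
open import Relation.Nullary using (Dec; yes; no; ¬_)
open import Relation.Nullary.Decidable using (_×-dec_; _⊎-dec_; _→-dec_; ¬?; decidable-stable)
open import Relation.Binary.PropositionalEquality
open import Data.List.Membership.DecPropositional _≟_ using () renaming (_∈?_ to _∈ℕ?_)
open import Algebra.Properties.CommutativeSemigroup +-commutativeSemigroup using (interchange)

-- Binary paths and heap indices

-- A node of the infinite binary tree is the path leading to it, listed
-- from the node upwards: `b ∷ p` is child `b` of `p`.
Path : Set
Path = List Bool

child : Bool → ℕ → ℕ
child false i = 2 * i
child true  i = 2 * i + 1

child-bounds : ∀ b i → 2 * i ≤ child b i × child b i < 2 * suc i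
child-bounds false i = ≤-refl , ≤-trans (n≤1+n _) (≤-reflexive (sym (*-suc 2 i)))
child-bounds true  i = m≤m+n (2 * i) 1 , ≤-reflexive (trans (cong suc (+-comm (2 * i) 1)) (sym (*-suc 2 i)))

heap : Path → ℕ
heap []      = 1
heap (b ∷ p) = child b (heap p)

heap-lower : ∀ p → 2 ^ length p ≤ heap p
heap-lower []      = ≤-refl
heap-lower (b ∷ p) = ≤-trans (*-monoʳ-≤ 2 (heap-lower p)) (proj₁ (child-bounds b (heap p)))

heap-upper : ∀ p → heap p < 2 ^ suc (length p)
heap-upper []      = s≤s (s≤s z≤n)
heap-upper (b ∷ p) = ≤-trans (proj₂ (child-bounds b (heap p))) (*-monoʳ-≤ 2 (heap-upper p))

heap-positive : ∀ p → 1 ≤ heap p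
heap-positive p = ≤-trans (m^n>0 2 (length p)) (heap-lower p)

child-injective : ∀ b c {i j} → child b i ≡ child c j → b ≡ c × i ≡ j
child-injective false false {i} {j} e = refl , *-cancelˡ-≡ i j 2 e
child-injective true  true  {i} {j} e = refl , *-cancelˡ-≡ i j 2 (+-cancelʳ-≡ 1 (2 * i) (2 * j) e)
child-injective false true  {i} {j} e = ⊥-elim (even≢odd i j (trans e (+-comm (2 * j) 1)))
child-injective true  false {i} {j} e = ⊥-elim (even≢odd j i (trans (sym e) (+-comm (2 * i) 1)))

child≢1 : ∀ b i → 1 ≤ i → child b i ≢ 1
child≢1 b i 1≤i e = <⇒≱ (*-monoʳ-≤ 2 1≤i) (≤-trans (proj₁ (child-bounds b i)) (≤-reflexive e))

heap-injective : ∀ p q → heap p ≡ heap q → p ≡ q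
heap-injective []      []      e = refl
heap-injective []      (c ∷ q) e = ⊥-elim (child≢1 c (heap q) (heap-positive q) (sym e))
heap-injective (b ∷ p) []      e = ⊥-elim (child≢1 b (heap p) (heap-positive p) e)
heap-injective (b ∷ p) (c ∷ q) e with child-injective b c e
... | refl , e′ = cong (b ∷_) (heap-injective p q e′)

heap-depth : ∀ p → ⌊log₂ heap p ⌋ ≡ length p
heap-depth []          = refl
heap-depth (false ∷ p) = trans (⌊log₂[2*b]⌋≡1+⌊log₂b⌋ (heap p) {{>-nonZero (heap-positive p)}}) (cong suc (heap-depth p))
heap-depth (true ∷ p)  = begin
    ⌊log₂ odd ⌋                ≡⟨ sym (m∸n+n≡m 1≤log) ⟩
    ⌊log₂ odd ⌋ ∸ 1 + 1        ≡⟨ cong (_+ 1) (sym (⌊log₂⌊n/2⌋⌋≡⌊log₂n⌋∸1 odd)) ⟩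
    ⌊log₂ ⌊ odd /2⌋ ⌋ + 1 ≡⟨ cong (λ x → ⌊log₂ x ⌋ + 1) (half-odd (heap p)) ⟩
    ⌊log₂ heap p ⌋ + 1         ≡⟨ cong (_+ 1) (heap-depth p) ⟩
    length p + 1               ≡⟨ +-comm (length p) 1 ⟩
    suc (length p)             ∎
  where
  open ≡-Reasoning
  odd : ℕ
  odd = 2 * heap p + 1
  half-odd : ∀ n → ⌊ 2 * n + 1 /2⌋ ≡ n
  half-odd zero    = refl
  half-odd (suc n) rewrite +-suc n (n + 0) = cong suc (half-odd n)
  1≤log : 1 ≤ ⌊log₂ odd ⌋
  1≤log = ≤-trans (s≤s z≤n)
            (≤-trans (≤-reflexive (sym (⌊log₂[2*b]⌋≡1+⌊log₂b⌋ (heap p) {{>-nonZero (heap-positive p)}})))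
                     (⌊log₂⌋-mono-≤ (m≤m+n (2 * heap p) 1)))

heap-shallow : ∀ {n} r D → suc (length r + D) ≤ n → heap r < 2 ^ n
heap-shallow r D shallow = ≤-trans (heap-upper r) (^-monoʳ-≤ 2 (≤-trans (s≤s (m≤m+n _ D)) shallow))

subtree below : ℕ → Path → List Path
subtree D c       = c ∷ below D c
below zero    c   = []
below (suc D) c   = subtree D (false ∷ c) ++ subtree D (true ∷ c)

Extends : ℕ → Path → Path → Set
Extends D c q = ∃ λ s → length s ≤ D × q ≡ s ++ c

extends-snoc : ∀ {D b c q} → Extends D (b ∷ c) q → Extends (suc D) c q
extends-snoc {b = b} {c} (s , |s|≤D , refl) =
  s ++ b ∷ [] , ≤-trans (≤-reflexive (trans (length-++ s) (+-comm (length s) 1))) (s≤s |s|≤D) , sym (++-assoc s (b ∷ []) c)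

subtree-extends : ∀ D c {q} → q ∈ subtree D c → Extends D c q
subtree-extends D       c (here refl) = [] , z≤n , refl
subtree-extends (suc D) c (there q∈) with ∈-++⁻ (subtree D (false ∷ c)) q∈
... | inj₁ q∈₀ = extends-snoc (subtree-extends D (false ∷ c) q∈₀)
... | inj₂ q∈₁ = extends-snoc (subtree-extends D (true ∷ c) q∈₁)

subtrees-disjoint : ∀ D D′ r b {q} → q ∈ subtree D (b ∷ r) → q ∈ subtree D′ (not b ∷ r) → ⊥
subtrees-disjoint D D′ r b q∈ q∈′ with subtree-extends D _ q∈ | subtree-extends D′ _ q∈′
... | s , _ , refl | s′ , _ , e = not-¬ refl (∷-injectiveˡ (cancel s s′ same-length e))
  where
  same-length : length s ≡ length s′
  same-length = +-cancelʳ-≡ (length (b ∷ r)) _ _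
    (trans (sym (length-++ s)) (trans (cong length e) (length-++ s′)))
  cancel : ∀ (s s′ : Path) {x y} → length s ≡ length s′ → s ++ x ≡ s′ ++ y → x ≡ y
  cancel []      []       _ e = e
  cancel (_ ∷ s) (_ ∷ s′) l e = cancel s s′ (suc-injective l) (∷-injectiveʳ e)

subtree⊆below : ∀ D r b {q} → q ∈ subtree D (b ∷ r) → q ∈ below (suc D) r
subtree⊆below D r false = ∈-++⁺ˡ
subtree⊆below D r true  = ∈-++⁺ʳ (subtree D (false ∷ r))

-- Bounded search over time intervals

Sometime Never : (ℕ → Set) → ℕ → ℕ → Set
Sometime Q a b = ∃ λ t → t < b × a ≤ t × Q t
Never    Q a b = ∀ {t} → t < b → a ≤ t → ¬ Q t

module _ {Q : ℕ → Set} (Q? : ∀ t → Dec (Q t)) where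

  sometime? : ∀ a b → Dec (Sometime Q a b)
  sometime? a b = anyUpTo? (λ t → (a ≤? t) ×-dec Q? t) b

  never? : ∀ a b → Dec (Never Q a b)
  never? a b = allUpTo? (λ t → (a ≤? t) →-dec ¬? (Q? t)) b

  sometime-or-never : ∀ a b → Sometime Q a b ⊎ Never Q a b
  sometime-or-never a b with sometime? a b
  ... | yes s = inj₁ s
  ... | no ¬s = inj₂ λ t<b a≤t q → ¬s (_ , t<b , a≤t , q)

  latest : ∀ a b → a ≤ b → Q a →
           ∃ λ t → a ≤ t × t ≤ b × Q t × (∀ {t′} → t < t′ → t′ ≤ b → ¬ Q t′)
  latest a b a≤b qa with Q? b
  ... | yes qb = b , a≤b , ≤-refl , qb , λ b<t′ t′≤b → ⊥-elim (<⇒≱ b<t′ t′≤b)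
  latest a zero    a≤b qa | no ¬qb rewrite n≤0⇒n≡0 a≤b = ⊥-elim (¬qb qa)
  latest a (suc b) a≤b qa | no ¬qb with m≤n⇒m<n∨m≡n a≤b
  ... | inj₂ refl = ⊥-elim (¬qb qa)
  ... | inj₁ (s≤s a≤b′) with latest a b a≤b′ qa
  ...   | t , a≤t , t≤b , qt , last = t , a≤t , m≤n⇒m≤1+n t≤b , qt , later
    where
    later : ∀ {t′} → t < t′ → t′ ≤ suc b → ¬ Q t′
    later {t′} t<t′ t′≤ with m≤n⇒m<n∨m≡n t′≤
    ... | inj₂ refl        = ¬qb
    ... | inj₁ (s≤s t′≤b) = last t<t′ t′≤b

-- Counting

words↔ : ∀ k n → Fin (k ^ n) ↔ Vec (Fin k) n
words↔ k n = ↔-trans (Fin[m^n]↔Fin[m]^n k n) (↔Vec n)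

encoding-bound : ∀ {A : Set} {k n r} (xs : List A)
                 (code : Vec (Fin k) n → A) (rest : Vec (Fin k) n → Vec (Fin k) r)
                 (decode : A → Vec (Fin k) r → Vec (Fin k) n) →
                 (∀ v → code v ∈ xs) → (∀ v → decode (code v) (rest v) ≡ v) →
                 k ^ n ≤ length xs * k ^ r
encoding-bound {k = k} {n} {r} xs code rest decode code∈ decoded = injective⇒≤ {f = f} f-injective
  where
  module W n = Inverse (words↔ k n)
  module Pairs = Inverse (*↔× {length xs} {k ^ r})
  f : Fin (k ^ n) → Fin (length xs * k ^ r)
  f i = Pairs.from (index (code∈ (W.to n i)) , W.from r (rest (W.to n i)))
  from-injective : ∀ {A B : Set} (I : A ↔ B) {x y} → Inverse.from I x ≡ Inverse.from I y → x ≡ y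
  from-injective I {x} {y} e = trans (sym (Inverse.strictlyInverseˡ I x))
                                      (trans (cong (Inverse.to I) e) (Inverse.strictlyInverseˡ I y))
  f-injective : Injective _≡_ _≡_ f
  f-injective {i} {j} e = begin
      i                          ≡⟨ sym (Inverse.strictlyInverseʳ (words↔ k n) i) ⟩
      W.from n v                 ≡⟨ cong (W.from n) (trans (sym (decoded v)) (cong₂ decode same-code same-rest)) ⟩
      W.from n (decode (code w) (rest w)) ≡⟨ cong (W.from n) (decoded w) ⟩
      W.from n w                 ≡⟨ Inverse.strictlyInverseʳ (words↔ k n) j ⟩
      j                          ∎
    where
    open ≡-Reasoning
    v w : Vec (Fin k) n
    v = W.to n i
    w = W.to n j
    pair-eq : (index (code∈ v) , W.from r (rest v)) ≡ (index (code∈ w) , W.from r (rest w))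
    pair-eq = from-injective (*↔× {length xs} {k ^ r}) e
    same-code : code v ≡ code w
    same-code = trans (lookup-index (code∈ v))
                  (trans (cong (lookup xs) (cong proj₁ pair-eq)) (sym (lookup-index (code∈ w))))
    same-rest : rest v ≡ rest w
    same-rest = from-injective (words↔ k r) (cong proj₂ pair-eq)

Σ₂ : (ℕ → ℕ) → ℕ → ℕ
Σ₂ f zero          = 0
Σ₂ f (suc zero)    = 0
Σ₂ f (suc (suc h)) = Σ₂ f (suc h) + f (suc (suc h))

powSum≡Σ₂ : ∀ k h → powSum k h ≡ Σ₂ (k ^_) h
powSum≡Σ₂ k zero          = refl
powSum≡Σ₂ k (suc zero)    = refl
powSum≡Σ₂ k (suc (suc h)) = cong (_+ k ^ suc (suc h)) (powSum≡Σ₂ k (suc h))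

Σ₂-mono : ∀ f g h → (∀ l → 2 ≤ l → l ≤ h → f l ≤ g l) → Σ₂ f h ≤ Σ₂ g h
Σ₂-mono f g zero          f≤g = z≤n
Σ₂-mono f g (suc zero)    f≤g = z≤n
Σ₂-mono f g (suc (suc h)) f≤g =
  +-mono-≤ (Σ₂-mono f g (suc h) λ l 2≤l l≤h → f≤g l 2≤l (m≤n⇒m≤1+n l≤h)) (f≤g _ (s≤s (s≤s z≤n)) ≤-refl)

Σ₂-vanish : ∀ f h → (∀ l → l ≤ h → f l ≡ 0) → Σ₂ f h ≡ 0
Σ₂-vanish f zero          f≡0 = refl
Σ₂-vanish f (suc zero)    f≡0 = refl
Σ₂-vanish f (suc (suc h)) f≡0 =
  cong₂ _+_ (Σ₂-vanish f (suc h) λ l l≤h → f≡0 l (m≤n⇒m≤1+n l≤h)) (f≡0 _ ≤-refl)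

Σ₂-+ : ∀ f g h → Σ₂ (λ l → f l + g l) h ≡ Σ₂ f h + Σ₂ g h
Σ₂-+ f g zero          = refl
Σ₂-+ f g (suc zero)    = refl
Σ₂-+ f g (suc (suc h)) =
  trans (cong (_+ (f (suc (suc h)) + g (suc (suc h)))) (Σ₂-+ f g (suc h)))
        (interchange (Σ₂ f (suc h)) (Σ₂ g (suc h)) (f (suc (suc h))) (g (suc (suc h))))

Σ₂-cong : ∀ f g h → (∀ l → f l ≡ g l) → Σ₂ f h ≡ Σ₂ g h
Σ₂-cong f g h f≡g = ≤-antisym (Σ₂-mono f g h λ l _ _ → ≤-reflexive (f≡g l))
                              (Σ₂-mono g f h λ l _ _ → ≤-reflexive (sym (f≡g l)))

indicator : ∀ {P : Set} → Dec P → ℕ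
indicator (yes _) = 1
indicator (no _)  = 0

length-filter-∷ : ∀ {A : Set} {P : A → Set} (P? : ∀ x → Dec (P x)) x xs →
                  length (filter P? (x ∷ xs)) ≡ indicator (P? x) + length (filter P? xs)
length-filter-∷ P? x xs with P? x
... | yes _ = refl
... | no _  = refl

Σ₂-indicator : ∀ m h → Σ₂ (λ l → indicator (m ≟ l)) h ≤ 1
Σ₂-indicator m zero          = z≤n
Σ₂-indicator m (suc zero)    = z≤n
Σ₂-indicator m (suc (suc h)) = add-last (m ≟ suc (suc h)) (Σ₂-indicator m (suc h))
  where
  add-last : (d : Dec (m ≡ suc (suc h))) → Σ₂ (λ l → indicator (m ≟ l)) (suc h) ≤ 1 →
             Σ₂ (λ l → indicator (m ≟ l)) (suc h) + indicator d ≤ 1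
  add-last (no _)   ih = ≤-trans (≤-reflexive (+-identityʳ _)) ih
  add-last (yes m≡) _  = ≤-reflexive (cong (_+ 1) (Σ₂-vanish _ (suc h) below-m))
    where
    below-m : ∀ l → l ≤ suc h → indicator (m ≟ l) ≡ 0
    below-m l l≤ with m ≟ l
    ... | yes m≡l = ⊥-elim (1+n≰n (≤-trans (≤-reflexive (trans (sym m≡) m≡l)) l≤))
    ... | no _    = refl

level-classes : ∀ {A : Set} (level : A → ℕ) h (xs : List A) →
                Σ₂ (λ l → length (filter (λ x → level x ≟ l) xs)) h ≤ length xs
level-classes level h []       = ≤-reflexive (Σ₂-vanish _ h λ _ _ → refl)
level-classes level h (x ∷ xs) = begin
  Σ₂ (λ l → length (filter (λ y → level y ≟ l) (x ∷ xs))) h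
    ≡⟨ Σ₂-cong _ _ h (λ l → length-filter-∷ (λ y → level y ≟ l) x xs) ⟩
  Σ₂ (λ l → indicator (level x ≟ l) + length (filter (λ y → level y ≟ l) xs)) h
    ≡⟨ Σ₂-+ _ _ h ⟩
  Σ₂ (λ l → indicator (level x ≟ l)) h + Σ₂ (λ l → length (filter (λ y → level y ≟ l) xs)) h
    ≤⟨ +-mono-≤ (Σ₂-indicator (level x) h) (level-classes level h xs) ⟩
  suc (length xs) ∎
  where open ≤-Reasoning

unique-bounded : ∀ {B} xs → Unique xs → All (λ j → 1 ≤ j × j < B) xs → length xs ≤ B ∸ 1
unique-bounded {B} xs unique bounded = injective⇒≤ {f = f} f-injective
  where
  in-range : ∀ i → 1 ≤ lookup xs i × lookup xs i < B
  in-range i = all-lookup bounded (∈-lookup i)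
  f : Fin (length xs) → Fin (B ∸ 1)
  f i = fromℕ< (∸-monoˡ-< (proj₂ (in-range i)) (proj₁ (in-range i)))
  lookup-injective : ∀ {ys} → Unique ys → ∀ i j → lookup ys i ≡ lookup ys j → i ≡ j
  lookup-injective (_  ∷ _) fzero    fzero    _ = refl
  lookup-injective (px ∷ _) fzero    (fsuc j) e = ⊥-elim (all-lookup px (∈-lookup j) e)
  lookup-injective (px ∷ _) (fsuc i) fzero    e = ⊥-elim (all-lookup px (∈-lookup i) (sym e))
  lookup-injective (_  ∷ u) (fsuc i) (fsuc j) e = cong fsuc (lookup-injective u i j e)
  f-injective : Injective _≡_ _≡_ f
  f-injective {i} {j} e = lookup-injective unique i j (begin
      lookup xs i             ≡⟨ sym (m∸n+n≡m (proj₁ (in-range i))) ⟩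
      lookup xs i ∸ 1 + 1     ≡⟨ cong (_+ 1) (sym (toℕ-fromℕ< _)) ⟩
      toℕ (f i) + 1           ≡⟨ cong (λ x → toℕ x + 1) e ⟩
      toℕ (f j) + 1           ≡⟨ cong (_+ 1) (toℕ-fromℕ< _) ⟩
      lookup xs j ∸ 1 + 1     ≡⟨ m∸n+n≡m (proj₁ (in-range j)) ⟩
      lookup xs j             ∎)
    where open ≡-Reasoning

at : ∀ {A : Set} {n} → A → Vec A n → ℕ → A
at a₀ []       _       = a₀
at a₀ (x ∷ _)  zero    = x
at a₀ (_ ∷ xs) (suc i) = at a₀ xs i

pad : ∀ {A : Set} → A → ∀ n → List A → Vec A n
pad a₀ zero    _        = []
pad a₀ (suc n) []       = a₀ ∷ pad a₀ n []
pad a₀ (suc n) (x ∷ xs) = x ∷ pad a₀ n xs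

at-pad : ∀ {A : Set} (a₀ : A) n ys x zs → length ys < n → at a₀ (pad a₀ n (ys ++ x ∷ zs)) (length ys) ≡ x
at-pad a₀ (suc n) []       x zs _         = refl
at-pad a₀ (suc n) (y ∷ ys) x zs (s≤s ys<n) = at-pad a₀ n ys x zs ys<n

at-lookup : ∀ {A : Set} (a₀ : A) {n} (v : Vec A n) i → at a₀ v (toℕ i) ≡ vlookup v i
at-lookup a₀ (x ∷ _)  fzero    = refl
at-lookup a₀ (_ ∷ xs) (fsuc i) = at-lookup a₀ xs i

bounded-on-words : ∀ {k n} (f : Vec (Fin k) n → ℕ) → ∃ λ B → ∀ v → f v ≤ B
bounded-on-words {k} {n} f = bound , λ v →
    subst (λ w → f w ≤ bound) (Inverse.strictlyInverseˡ (words↔ k n) v) (bounded-on-Fin (f ∘ Inverse.to (words↔ k n)) _)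
  where
  maximum : ∀ {m} → (Fin m → ℕ) → ℕ
  maximum {zero}  g = 0
  maximum {suc m} g = g fzero ⊔ maximum (g ∘ fsuc)
  bounded-on-Fin : ∀ {m} (g : Fin m → ℕ) i → g i ≤ maximum g
  bounded-on-Fin g fzero    = m≤m⊔n _ _
  bounded-on-Fin g (fsuc i) = ≤-trans (bounded-on-Fin (g ∘ fsuc) i) (m≤n⊔m _ _)
  bound : ℕ
  bound = maximum (f ∘ Inverse.to (words↔ k n))

-- Inputs given by node labellings

module Labelled (h : ℕ) {k : ℕ} where

  InTree : ℕ → Set
  InTree j = 1 ≤ j × j < 2 ^ h

  child-in-tree : ∀ {i} → Internal h i → ∀ b → InTree (child b i)
  child-in-tree {i} (1≤i , i<) b =
    ≤-trans 1≤i (≤-trans (m≤m+n i (i + 0)) (proj₁ (child-bounds b i))) ,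
    ≤-trans (proj₂ (child-bounds b i)) (≤-trans (*-monoʳ-≤ 2 i<) (double-power h 1≤i i<))
    where
    double-power : ∀ h → 1 ≤ i → i < 2 ^ (h ∸ 1) → 2 * 2 ^ (h ∸ 1) ≤ 2 ^ h
    double-power zero    1≤i i<1 = ⊥-elim (<⇒≱ i<1 1≤i)
    double-power (suc h) _   _   = ≤-refl

  -- A labelling gives each node a value; as an input, each internal node
  -- gets the constant function with that value.
  Labelling : Set
  Labelling = ℕ → Fin k

  input : Labelling → Input h k
  input V (fvar i _ _ _) = V i
  input V (lvar i _)     = V i

  -- Evaluating node j with fuel n suffices when 2 ^ h ≤ j * 2 ^ n;
  -- this condition passes from a node to its children.
  fuel-child : ∀ j n → 2 ^ h ≤ j * 2 ^ suc n → ∀ b → 2 ^ h ≤ child b j * 2 ^ n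
  fuel-child j n fuel b = ≤-trans fuel (≤-trans (≤-reflexive double-fuel) (*-monoˡ-≤ (2 ^ n) (proj₁ (child-bounds b j))))
    where
    double-fuel : j * 2 ^ suc n ≡ 2 * j * 2 ^ n
    double-fuel = trans (sym (*-assoc j 2 (2 ^ n))) (cong (_* 2 ^ n) (*-comm j 2))

  valF-input : ∀ V n j → InTree j → 2 ^ h ≤ j * 2 ^ n → valF (input V) n j ≡ just (V j)
  valF-input V zero    j (_ , j<) fuel = ⊥-elim (<⇒≱ j< (≤-trans fuel (≤-reflexive (*-identityʳ j))))
  valF-input V (suc n) j (1≤j , j<) fuel with leaf? h j | internal? h j
  ... | yes _ | _       = refl
  ... | no ¬l | no ¬i   = ⊥-elim (¬i (1≤j , ≰⇒> λ j≥ → ¬l (j≥ , j<)))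
  ... | no _  | yes int
    rewrite valF-input V n (child false j) (child-in-tree int false) (fuel-child j n fuel false)
          | valF-input V n (child true j)  (child-in-tree int true)  (fuel-child j n fuel true) = refl

  nodeVal-input : ∀ V j → InTree j → nodeVal {h} (input V) j ≡ just (V j)
  nodeVal-input V j j-tree = valF-input V h j j-tree
    (≤-trans (≤-reflexive (sym (*-identityˡ (2 ^ h)))) (*-monoˡ-≤ (2 ^ h) (proj₁ j-tree)))

  BT-input : 1 ≤ h → ∀ V → BT h k (input V) ≡ (toℕ (V 1) ≡ᵇ 0)
  BT-input 1≤h V rewrite nodeVal-input V 1 (≤-refl , ^-monoʳ-≤ 2 1≤h) = refl

-- Runs of a branching program on labellings

module Runs (h k′ : ℕ) (P : BP (Var h (suc (suc k′))) (suc (suc k′))) where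

  k : ℕ
  k = suc (suc k′)

  open BP P using (size; node)
  open Labelled h {k} public

  -- What a nonfinal state does: it reads the label of a tree node, and
  -- for a thrifty program a query f_i(a,b) certifies the labels a, b of
  -- the children of i.
  record Query : Set where
    field
      target  : ℕ
      reveals : List (ℕ × Fin k)
      next    : Fin k → Fin size
  open Query public

  queryOf : Var h k → (Fin k → Fin size) → Query
  queryOf (fvar i _ a b) nx = record { target = i ; reveals = (child false i , a) ∷ (child true i , b) ∷ [] ; next = nx }
  queryOf (lvar i _)     nx = record { target = i ; reveals = [] ; next = nx }

  query : Fin size → Maybe Query
  query s with node s
  ... | inj₁ (x , nx) = just (queryOf x nx)
  ... | inj₂ _        = nothing

  step-query : ∀ V s {q} → query s ≡ just q → step P (input V) s ≡ next q (V (target q))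
  step-query V s e with node s
  step-query V s refl | inj₁ (fvar _ _ _ _ , _) = refl
  step-query V s refl | inj₁ (lvar _ _ , _)     = refl

  step-final : ∀ V s → query s ≡ nothing → step P (input V) s ≡ s
  step-final V s e with node s
  ... | inj₂ _ = refl

  final-query : ∀ {s b} → node s ≡ inj₂ b → query s ≡ nothing
  final-query {s} e with node s
  final-query refl | inj₂ _ = refl

  state : Labelling → ℕ → Fin size
  state V t = run P (input V) t

  QueriesAt : Labelling → ℕ → ℕ → Set
  QueriesAt V t j = ∃ λ q → query (state V t) ≡ just q × target q ≡ j

  QueriesAt? : ∀ V t j → Dec (QueriesAt V t j)
  QueriesAt? V t j with query (state V t)
  ... | nothing = no λ { (_ , () , _) }
  ... | just q with target q ≟ j
  ...   | yes e  = yes (q , refl , e)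
  ...   | no  ≢j = no λ { (_ , refl , e) → ≢j e }

  level : Fin size → ℕ
  level s with query s
  ... | just q  = 2 + ⌊log₂ target q ⌋
  ... | nothing = 0

  level-queried : ∀ V t u → QueriesAt V t (heap u) → level (state V t) ≡ 2 + length u
  level-queried V t u (q , e , target≡) with query (state V t)
  level-queried V t u (q , refl , target≡) | just q =
    trans (cong (λ x → 2 + ⌊log₂ x ⌋) target≡) (cong (2 +_) (heap-depth u))

  QueriedIn NotQueriedIn : Labelling → ℕ → ℕ → ℕ → Set
  QueriedIn    V c = Sometime (λ t → QueriesAt V t c)
  NotQueriedIn V c = Never    (λ t → QueriesAt V t c)

  step-local : ∀ V W s → (∀ {q} → query s ≡ just q → V (target q) ≡ W (target q)) →
               step P (input V) s ≡ step P (input W) s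
  step-local V W s agree with query s in eq
  ... | nothing = trans (step-final V s eq) (sym (step-final W s eq))
  ... | just q  = trans (step-query V s eq) (trans (cong (next q) (agree refl)) (sym (step-query W s eq)))

  run-local : ∀ V W t → (∀ {t′ j} → t′ < t → QueriesAt V t′ j → V j ≡ W j) → state V t ≡ state W t
  run-local V W zero    agree = refl
  run-local V W (suc t) agree =
    trans (step-local V W (state V t) λ e → agree ≤-refl (_ , e , refl))
          (cong (step P (input W)) (run-local V W t λ t′<t → agree (m≤n⇒m≤1+n t′<t)))

  stays-final : ∀ V t {b} → node (state V t) ≡ inj₂ b → ∀ t′ → t ≤ t′ → state V t′ ≡ state V t
  stays-final V t fin t′ t≤t′ with m≤n⇒∃[o]m+o≡n t≤t′
  ... | d , refl = go d
    where
    go : ∀ d → state V (t + d) ≡ state V t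
    go zero    = cong (state V) (+-identityʳ t)
    go (suc d) = begin
      state V (t + suc d)                ≡⟨ cong (state V) (+-suc t d) ⟩
      step P (input V) (state V (t + d)) ≡⟨ cong (step P (input V)) (go d) ⟩
      step P (input V) (state V t)       ≡⟨ step-final V _ (final-query fin) ⟩
      state V t                          ∎
      where open ≡-Reasoning

  other : Fin k → Fin k
  other fzero    = fsuc fzero
  other (fsuc _) = fzero

  other-≢ : ∀ v → other v ≢ v
  other-≢ fzero    ()
  other-≢ (fsuc _) ()

  flip : Labelling → ℕ → Labelling
  flip V c j with j ≟ c
  ... | yes _ = other (V c)
  ... | no  _ = V j

  flip-at : ∀ V c → flip V c c ≢ V c
  flip-at V c with c ≟ c
  ... | yes _ = other-≢ (V c)
  ... | no c≢c = ⊥-elim (c≢c refl)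

  flip-elsewhere : ∀ V c j → j ≢ c → flip V c j ≡ V j
  flip-elsewhere V c j j≢c with j ≟ c
  ... | yes j≡c = ⊥-elim (j≢c j≡c)
  ... | no  _   = refl

  queried-if-sensitive : ∀ V c t → state (flip V c) t ≢ state V t → QueriedIn V c 0 t
  queried-if-sensitive V c t changed with sometime-or-never (λ t′ → QueriesAt? V t′ c) 0 t
  ... | inj₁ queried = queried
  ... | inj₂ never   = ⊥-elim (changed (sym (run-local V (flip V c) t agree)))
    where
    agree : ∀ {t′ j} → t′ < t → QueriesAt V t′ j → V j ≡ flip V c j
    agree t′<t (q , eq , refl) = sym (flip-elsewhere V c _ λ { refl → never t′<t z≤n (q , eq , refl) })

  -- A decoder replays the program from some state with partial knowledge
  -- of the labels: certified child labels are learnt, and a queried label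
  -- that is still unknown is read from an oracle.

  Knowledge : Set
  Knowledge = ℕ → Maybe (Fin k)

  record Memory : Set where
    constructor memory
    field
      known : Knowledge
      read  : List ℕ
  open Memory public

  Known : Knowledge → ℕ → Set
  Known K j = ∃ λ v → K j ≡ just v

  learn : ℕ → Fin k → Knowledge → Knowledge
  learn j v K x with x ≟ j
  ... | yes _ = just v
  ... | no  _ = K x

  learnAll : List (ℕ × Fin k) → Knowledge → Knowledge
  learnAll []             K = K
  learnAll ((j , v) ∷ rs) K = learnAll rs (learn j v K)

  -- An oracle supplies the label of a node, given the nodes read so far.
  Oracle : Set
  Oracle = List ℕ → ℕ → Fin k

  consult : Oracle → ℕ → Memory → Fin k × Memory
  consult o j (memory K L) with K j
  ... | just v  = v , memory K L
  ... | nothing = o L j , memory (learn j (o L j) K) (L ++ j ∷ [])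

  Config : Set
  Config = Fin size × Memory

  prepare : Query → Memory → Memory
  prepare q M = memory (learnAll (reveals q) (known M)) (read M)

  respond : Oracle → Query → Memory → Config
  respond o q M = map₁ (next q) (consult o (target q) (prepare q M))

  simulate-step : Oracle → Config → Config
  simulate-step o (s , M) with query s
  ... | nothing = s , M
  ... | just q  = respond o q M

  simulate : Oracle → ℕ → Config → Config
  simulate o zero    c = c
  simulate o (suc n) c = simulate-step o (simulate o n c)

  fill : Oracle → List ℕ → Memory → Memory
  fill o []       M = M
  fill o (j ∷ js) M = fill o js (proj₂ (consult o j M))

  _≼_ : List ℕ → List ℕ → Set
  L ≼ L′ = ∃ λ r → L′ ≡ L ++ r

  ≼-refl : ∀ L → L ≼ L
  ≼-refl L = [] , sym (++-identityʳ L)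

  ≼-trans : ∀ {L L′ L″} → L ≼ L′ → L′ ≼ L″ → L ≼ L″
  ≼-trans {L} (r , refl) (r′ , refl) = r ++ r′ , ++-assoc L r r′

  read-before : ∀ {L j L₁} → (L ++ j ∷ []) ≼ L₁ → suc (length L) ≤ length L₁
  read-before {L} {j} (r , refl) = begin
      suc (length L)                  ≡⟨ +-comm 1 (length L) ⟩
      length L + 1                    ≡⟨ sym (length-++ L) ⟩
      length (L ++ j ∷ [])            ≤⟨ m≤m+n _ (length r) ⟩
      length (L ++ j ∷ []) + length r ≡⟨ sym (length-++ (L ++ j ∷ [])) ⟩
      length ((L ++ j ∷ []) ++ r)     ∎
    where open ≤-Reasoning

  consult-grows : ∀ o j M → read M ≼ read (proj₂ (consult o j M))
  consult-grows o j (memory K L) with K j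
  ... | just _  = ≼-refl L
  ... | nothing = j ∷ [] , refl

  step-grows : ∀ o c → read (proj₂ c) ≼ read (proj₂ (simulate-step o c))
  step-grows o (s , M) with query s
  ... | nothing = ≼-refl (read M)
  ... | just q  = consult-grows o (target q) (prepare q M)

  simulate-grows : ∀ o c {m n} → m ≤ n → read (proj₂ (simulate o m c)) ≼ read (proj₂ (simulate o n c))
  simulate-grows o c {n = zero}  z≤n = ≼-refl _
  simulate-grows o c {m} {suc n} m≤ with m≤n⇒m<n∨m≡n m≤
  ... | inj₂ refl       = ≼-refl _
  ... | inj₁ (s≤s m≤n) = ≼-trans (simulate-grows o c m≤n) (step-grows o (simulate o n c))

  fill-grows : ∀ o js M → read M ≼ read (fill o js M)
  fill-grows o []       M = ≼-refl _
  fill-grows o (j ∷ js) M = ≼-trans (consult-grows o j M) (fill-grows o js _)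

  Interchangeable : Oracle → Oracle → List ℕ → Set
  Interchangeable o₁ o₂ L₁ = ∀ L j → (L ++ j ∷ []) ≼ L₁ → o₁ L j ≡ o₂ L j

  consult-agree : ∀ {o₁ o₂ L₁} → Interchangeable o₁ o₂ L₁ → ∀ j M →
                  read (proj₂ (consult o₁ j M)) ≼ L₁ → consult o₁ j M ≡ consult o₂ j M
  consult-agree same j (memory K L) within with K j
  ... | just _  = refl
  ... | nothing rewrite same L j within = refl

  step-agree : ∀ {o₁ o₂ L₁} → Interchangeable o₁ o₂ L₁ → ∀ c →
               read (proj₂ (simulate-step o₁ c)) ≼ L₁ → simulate-step o₁ c ≡ simulate-step o₂ c
  step-agree same (s , M) within with query s
  ... | nothing = refl
  ... | just q  = cong (map₁ (next q)) (consult-agree same (target q) (prepare q M) within)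

  simulate-agree : ∀ {o₁ o₂ L₁} → Interchangeable o₁ o₂ L₁ → ∀ n c →
                   read (proj₂ (simulate o₁ n c)) ≼ L₁ → simulate o₁ n c ≡ simulate o₂ n c
  simulate-agree same zero    c within = refl
  simulate-agree same (suc n) c within =
    trans (step-agree same (simulate _ n c) within)
          (cong (simulate-step _) (simulate-agree same n c (≼-trans (step-grows _ (simulate _ n c)) within)))

  fill-agree : ∀ {o₁ o₂ L₁} → Interchangeable o₁ o₂ L₁ → ∀ js M →
               read (fill o₁ js M) ≼ L₁ → fill o₁ js M ≡ fill o₂ js M
  fill-agree same []       M within = refl
  fill-agree same (j ∷ js) M within =
    trans (fill-agree same js _ within)
          (cong (λ c → fill _ js (proj₂ c)) (consult-agree same j M (≼-trans (fill-grows _ js _) within)))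

  learn-hit : ∀ j v K → learn j v K j ≡ just v
  learn-hit j v K with j ≟ j
  ... | yes _  = refl
  ... | no j≢j = ⊥-elim (j≢j refl)

  learn-keeps : ∀ j v K {x} → Known K x → Known (learn j v K) x
  learn-keeps j v K {x} known-x with x ≟ j
  ... | yes _ = v , refl
  ... | no  _ = known-x

  learnAll-keeps : ∀ rs K {x} → Known K x → Known (learnAll rs K) x
  learnAll-keeps []             K known-x = known-x
  learnAll-keeps ((j , v) ∷ rs) K known-x = learnAll-keeps rs _ (learn-keeps j v K known-x)

  learnAll-learns : ∀ rs K {j} → j ∈ map proj₁ rs → Known (learnAll rs K) j
  learnAll-learns ((j , v) ∷ rs) K (here refl) = learnAll-keeps rs _ (v , learn-hit j v K)
  learnAll-learns (_ ∷ rs)       K (there j∈)  = learnAll-learns rs _ j∈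

  consult-keeps : ∀ o j M {x} → Known (known M) x → Known (known (proj₂ (consult o j M))) x
  consult-keeps o j (memory K L) known-x with K j
  ... | just _  = known-x
  ... | nothing = learn-keeps j _ K known-x

  consult-knows : ∀ o j M → Known (known (proj₂ (consult o j M))) j
  consult-knows o j (memory K L) with K j in eq
  ... | just v  = v , eq
  ... | nothing = _ , learn-hit j _ K

  consult-reads : ∀ o j M {x} → x ∈ read (proj₂ (consult o j M)) → x ∈ read M ⊎ (x ≡ j × known M j ≡ nothing)
  consult-reads o j (memory K L) x∈ with K j
  ... | just _  = inj₁ x∈
  ... | nothing with ∈-++⁻ L x∈
  ...   | inj₁ x∈L         = inj₁ x∈L
  ...   | inj₂ (here refl) = inj₂ (refl , refl)

  fill-keeps : ∀ o js M {x} → Known (known M) x → Known (known (fill o js M)) x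
  fill-keeps o []       M known-x = known-x
  fill-keeps o (j ∷ js) M known-x = fill-keeps o js _ (consult-keeps o j M known-x)

  fill-knows : ∀ o js M {x} → x ∈ js → Known (known (fill o js M)) x
  fill-knows o (j ∷ js) M (here refl) = fill-keeps o js _ (consult-knows o j M)
  fill-knows o (j ∷ js) M (there x∈)  = fill-knows o js _ x∈

  fill-unread : ∀ o js M {x} → Known (known M) x → x ∉ read M → x ∉ read (fill o js M)
  fill-unread o []       M known-x unread = unread
  fill-unread o (j ∷ js) M known-x unread =
    fill-unread o js _ (consult-keeps o j M known-x) λ x∈ → case consult-reads o j M x∈ of λ
      { (inj₁ x∈M)        → unread x∈M
      ; (inj₂ (refl , e)) → case trans (sym (proj₂ known-x)) e of λ () }

  Sound : Labelling → Knowledge → Set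
  Sound V K = ∀ j {v} → K j ≡ just v → V j ≡ v

  learn-sound : ∀ V {K} j {v} → Sound V K → V j ≡ v → Sound V (learn j v K)
  learn-sound V j sound correct x e with x ≟ j
  learn-sound V j sound correct x refl | yes refl = correct
  ... | no _ = sound x e

  learnAll-sound : ∀ V rs {K} → Sound V K → All (λ r → V (proj₁ r) ≡ proj₂ r) rs → Sound V (learnAll rs K)
  learnAll-sound V []             sound []                = sound
  learnAll-sound V ((j , v) ∷ rs) sound (correct ∷ rest) = learnAll-sound V rs (learn-sound V j sound correct) rest

  labelsOracle : Labelling → Oracle
  labelsOracle V _ j = V j

  record Accurate (V : Labelling) (M : Memory) : Set where
    field
      sound       : Sound V (known M)
      read-unique : Unique (read M)
      read-known  : All (Known (known M)) (read M)
      read-tree   : All InTree (read M)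

  consult-accurate : ∀ V j M → InTree j → Accurate V M →
                     proj₁ (consult (labelsOracle V) j M) ≡ V j × Accurate V (proj₂ (consult (labelsOracle V) j M))
  consult-accurate V j (memory K L) j-tree acc with K j in eq
  ... | just v  = sym (Accurate.sound acc j eq) , acc
  ... | nothing = refl , record
    { sound       = learn-sound V j (Accurate.sound acc) refl
    ; read-unique = Unique-++⁺ (Accurate.read-unique acc) ([] ∷ []) λ { (j′∈ , here refl) → unknown-unread j′∈ }
    ; read-known  = ++⁺ (all-map (learn-keeps j _ K) (Accurate.read-known acc)) ((V j , learn-hit j (V j) K) ∷ [])
    ; read-tree   = ++⁺ (Accurate.read-tree acc) (j-tree ∷ []) }
    where
    unknown-unread : j ∉ L
    unknown-unread j∈ with all-lookup (Accurate.read-known acc) j∈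
    ... | v , e = case trans (sym eq) e of λ ()

  prepare-accurate : ∀ V q M → All (λ r → V (proj₁ r) ≡ proj₂ r) (reveals q) → Accurate V M → Accurate V (prepare q M)
  prepare-accurate V q M correct acc = record
    { sound       = learnAll-sound V (reveals q) (Accurate.sound acc) correct
    ; read-unique = Accurate.read-unique acc
    ; read-known  = all-map (learnAll-keeps (reveals q) (known M)) (Accurate.read-known acc)
    ; read-tree   = Accurate.read-tree acc }

  fill-accurate : ∀ V js M → All InTree js → Accurate V M → Accurate V (fill (labelsOracle V) js M)
  fill-accurate V []       M []             acc = acc
  fill-accurate V (j ∷ js) M (j-tree ∷ rest) acc = fill-accurate V js _ rest (proj₂ (consult-accurate V j M j-tree acc))

  target-in-tree : ∀ s {q} → query s ≡ just q → InTree (target q)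
  target-in-tree s e with node s
  target-in-tree s refl | inj₁ (fvar i (1≤i , i<) _ _ , _) = 1≤i , ≤-trans i< (^-monoʳ-≤ 2 (m∸n≤m h 1))
  target-in-tree s refl | inj₁ (lvar i (2^≤i , i<) , _)    = ≤-trans (m^n>0 2 (h ∸ 1)) 2^≤i , i<

  module ThriftySolver (thrifty : Thrifty h k P) (computes : Computes P (BT h k)) (1≤h : 1 ≤ h) where

    reveals-correct : ∀ V t {q} → query (state V t) ≡ just q → All (λ r → V (proj₁ r) ≡ proj₂ r) (reveals q)
    reveals-correct V t e with node (state V t) in eq
    reveals-correct V t refl | inj₁ (lvar _ _ , _) = []
    reveals-correct V t refl | inj₁ (fvar i int a b , nx) with thrifty (input V) t i int a b nx eq
    ... | val₀ , val₁ = correct false val₀ ∷ correct true val₁ ∷ []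
      where
      correct : ∀ c {v} → nodeVal {h} (input V) (child c i) ≡ just v → V (child c i) ≡ v
      correct c val = just-injective (trans (sym (nodeVal-input V _ (child-in-tree int c))) val)

    halt : Labelling → ℕ
    halt V = proj₁ (computes (input V))

    halted : ∀ V → node (state V (halt V)) ≡ inj₂ (BT h k (input V))
    halted V = proj₂ (computes (input V))

    output-unique : ∀ V t {b} → node (state V t) ≡ inj₂ b → b ≡ BT h k (input V)
    output-unique V t {b} fin = inj₂-injective (begin
        inj₂ b                                    ≡⟨ sym fin ⟩
        node (state V t)                          ≡⟨ cong node (sym (stays-final V t fin (t ⊔ halt V) (m≤m⊔n _ _))) ⟩
        node (state V (t ⊔ halt V))               ≡⟨ cong node (stays-final V (halt V) (halted V) (t ⊔ halt V) (m≤n⊔m _ _)) ⟩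
        node (state V (halt V))                   ≡⟨ halted V ⟩
        inj₂ (BT h k (input V))                   ∎)
      where open ≡-Reasoning

    queries-before-halt : ∀ V t j → QueriesAt V t j → t < halt V
    queries-before-halt V t j (q , e , _) with t <? halt V
    ... | yes t< = t<
    ... | no  t≮ = case trans (sym (final-query halted′)) e of λ ()
      where
      halted′ : node (state V t) ≡ inj₂ (BT h k (input V))
      halted′ = trans (cong node (stays-final V (halt V) (halted V) t (≮⇒≥ t≮))) (halted V)

    root-queried : ∀ V → QueriedIn V 1 0 (halt V)
    root-queried V = queried-if-sensitive V 1 (halt V) λ same →
      answer-flips (V 1) (trans (sym (BT-input 1≤h (flip V 1)))
        (trans (sym (output-unique (flip V 1) (halt V) (trans (cong node same) (halted V)))) (BT-input 1≤h V)))
      where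
      answer-flips : ∀ v → (toℕ (other v) ≡ᵇ 0) ≢ (toℕ v ≡ᵇ 0)
      answer-flips fzero    ()
      answer-flips (fsuc _) ()

    Certifies : Labelling → ℕ → ℕ → Set
    Certifies V t j = ∃ λ q → query (state V t) ≡ just q × j ∈ map proj₁ (reveals q)

    -- A node whose label is certified at time t was queried before t: its
    -- label is determined by the state at t.
    certified-queried : ∀ V t j → Certifies V t j → QueriedIn V j 0 t
    certified-queried V t j (q , e , j∈) with ∈-map⁻ proj₁ j∈
    ... | (_ , a) , r∈ , refl = queried-if-sensitive V j t λ same →
      flip-at V j (trans (certified (flip V j) (trans (cong query same) e)) (sym (certified V e)))
      where
      certified : ∀ W → query (state W t) ≡ just q → W j ≡ a
      certified W eW = all-lookup (reveals-correct W t eW) r∈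

    internal-certifies : ∀ V t i → QueriesAt V t i → i < 2 ^ (h ∸ 1) → ∀ b → Certifies V t (child b i)
    internal-certifies V t i (q , e , refl) i< b with node (state V t)
    internal-certifies V t _ (_ , refl , refl) i< false | inj₁ (fvar i _ a _ , nx) = _ , refl , here refl
    internal-certifies V t _ (_ , refl , refl) i< true  | inj₁ (fvar i _ _ b , nx) = _ , refl , there (here refl)
    internal-certifies V t _ (_ , refl , refl) i< b     | inj₁ (lvar i (2^≤i , _) , nx) = ⊥-elim (<⇒≱ i< 2^≤i)

    Pending : Labelling → ℕ → ℕ → Set
    Pending V t j = Sometime (λ t′ → Certifies V t′ j × NotQueriedIn V j t t′) t (halt V)

    Certifies? : ∀ V t j → Dec (Certifies V t j)
    Certifies? V t j with query (state V t)
    ... | nothing = no λ { (_ , () , _) }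
    ... | just q with j ∈ℕ? map proj₁ (reveals q)
    ...   | yes j∈ = yes (q , refl , j∈)
    ...   | no  j∉ = no λ { (_ , refl , j∈) → j∉ j∈ }

    Pending? : ∀ V t j → Dec (Pending V t j)
    Pending? V t j = sometime? (λ t′ → Certifies? V t′ j ×-dec never? (λ t″ → QueriesAt? V t″ j) t t′) t (halt V)

    -- Nothing is pending at time 0: a certified label was queried before.
    nothing-pending-initially : ∀ V j → ¬ Pending V 0 j
    nothing-pending-initially V j (t′ , _ , _ , cert , not-queried) with certified-queried V t′ j cert
    ... | t″ , t″<t′ , _ , queried = not-queried t″<t′ z≤n queried

    children-pending : ∀ V T i → QueriesAt V T i → i < 2 ^ (h ∸ 1) → ∀ b → Pending V T (child b i)
    children-pending V T i queried i< b =
      T , queries-before-halt V T i queried , ≤-refl , internal-certifies V T i queried i< b , λ T<T T≤ → ⊥-elim (<⇒≱ T<T T≤)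

    module Pebbling (V : Labelling) where

      Quiet : ℕ → List Path → Set
      Quiet t xs = ¬ Any (λ q → Pending V t (heap q)) xs

      quiet? : ∀ t xs → Dec (Quiet t xs)
      quiet? t xs = ¬? (any? (λ q → Pending? V t (heap q)) xs)

      pending-in : ∀ {t xs} → ¬ Quiet t xs → ∃ λ q → q ∈ xs × Pending V t (heap q)
      pending-in {t} {xs} loud = find (decidable-stable (any? (λ q → Pending? V t (heap q)) xs) loud)

      record Critical (D : ℕ) (r : Path) (t₀ T : ℕ) : Set where
        field
          τ               : ℕ
          t₀<τ            : t₀ < τ
          τ≤T             : τ ≤ T
          current         : Path
          current-depth   : length current ≡ length r + D
          current-queried : QueriesAt V τ (heap current)
          pebbles         : List Path
          pebbles-unique  : Unique pebbles
          pebbles-count   : length pebbles ≡ suc (suc D)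
          pebbles-below   : All (_∈ below (suc D) r) pebbles
          pebbles-pending : All (λ q → Pending V τ (heap q)) pebbles

      critical-parent : ∀ D r b {t₀ t₁ t₂ T} → t₀ ≤ t₁ → t₂ ≤ T → (c : Critical D (b ∷ r) t₁ t₂) →
                        (∃ λ q′ → q′ ∈ subtree (suc D) (not b ∷ r) × Pending V (Critical.τ c) (heap q′)) →
                        Critical (suc D) r t₀ T
      critical-parent D r b t₀≤t₁ t₂≤T c (q′ , q′∈ , q′-pending) = record
        { τ = τ ; t₀<τ = ≤-trans (s≤s t₀≤t₁) t₀<τ ; τ≤T = ≤-trans τ≤T t₂≤T
        ; current = current ; current-depth = trans current-depth (sym (+-suc (length r) D))
        ; current-queried = current-queried
        ; pebbles = q′ ∷ pebbles
        ; pebbles-unique = all-map new pebbles-below ∷ pebbles-unique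
        ; pebbles-count = cong suc pebbles-count
        ; pebbles-below = subtree⊆below (suc D) r (not b) q′∈ ∷ all-map (subtree⊆below (suc D) r b ∘ there) pebbles-below
        ; pebbles-pending = q′-pending ∷ pebbles-pending }
        where
        open Critical c
        new : ∀ {p} → p ∈ below (suc D) (b ∷ r) → q′ ≢ p
        new p∈ refl = subtrees-disjoint (suc D) (suc D) r b (there p∈) q′∈

      -- If r is queried at T and nothing below r is pending at t₀ ≤ T, there
      -- is a critical time in (t₀ , T].  Induction on D: after the last time
      -- t₁ at which one child subtree of r is quiet, that child is queried;
      -- a critical time for the child after t₁ extends to one for r, since
      -- the other child subtree is no longer quiet.
      critical : ∀ D r {t₀ T} → suc (length r + D) ≤ h ∸ 1 → QueriesAt V T (heap r) → t₀ ≤ T →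
                 Quiet t₀ (below (suc D) r) → Critical D r t₀ T
      critical zero r {t₀} {T} shallow queried t₀≤T quiet = record
        { τ = T ; t₀<τ = ≤∧≢⇒< t₀≤T λ { refl → quiet (here (pend false)) } ; τ≤T = ≤-refl
        ; current = r ; current-depth = sym (+-identityʳ _) ; current-queried = queried
        ; pebbles = (false ∷ r) ∷ (true ∷ r) ∷ [] ; pebbles-unique = ((λ ()) ∷ []) ∷ [] ∷ []
        ; pebbles-count = refl ; pebbles-below = here refl ∷ there (here refl) ∷ []
        ; pebbles-pending = pend false ∷ pend true ∷ [] }
        where
        pend : ∀ b → Pending V T (heap (b ∷ r))
        pend = children-pending V T (heap r) queried (heap-shallow r _ shallow)
      critical (suc D) r {t₀} {T} shallow queried t₀≤T quiet
        with latest (λ t → quiet? t (subtree (suc D) (false ∷ r)) ⊎-dec quiet? t (subtree (suc D) (true ∷ r)))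
                    t₀ T t₀≤T (inj₁ (quiet ∘ Any-++⁺ˡ))
      ... | t₁ , t₀≤t₁ , t₁≤T , quiet-side , last = from-side quiet-side
        where
        side : ∀ b {t} → Quiet t (subtree (suc D) (b ∷ r)) →
               Quiet t (subtree (suc D) (false ∷ r)) ⊎ Quiet t (subtree (suc D) (true ∷ r))
        side false = inj₁
        side true  = inj₂
        continue : ∀ b → Quiet t₁ (subtree (suc D) (b ∷ r)) → Critical (suc D) r t₀ T
        continue b quiet₁ with sometime-or-never (λ t → QueriesAt? V t (heap (b ∷ r))) t₁ T
        ... | inj₂ never = ⊥-elim (quiet₁ (here (T , queries-before-halt V T _ queried , t₁≤T ,
                                              internal-certifies V T _ queried (heap-shallow r _ shallow) b , never)))
        ... | inj₁ (t₂ , t₂<T , t₁≤t₂ , queried₂) =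
          critical-parent D r b t₀≤t₁ (<⇒≤ t₂<T) child-critical (pending-in other-loud)
          where
          child-critical : Critical D (b ∷ r) t₁ t₂
          child-critical = critical D (b ∷ r) (≤-trans (≤-reflexive (cong suc (sym (+-suc (length r) D)))) shallow)
                                    queried₂ t₁≤t₂ (quiet₁ ∘ there)
          other-loud : ¬ Quiet (Critical.τ child-critical) (subtree (suc D) (not b ∷ r))
          other-loud quiet′ = last (Critical.t₀<τ child-critical) (≤-trans (Critical.τ≤T child-critical) (<⇒≤ t₂<T))
                                   (side (not b) quiet′)
        from-side : Quiet t₁ (subtree (suc D) (false ∷ r)) ⊎ Quiet t₁ (subtree (suc D) (true ∷ r)) → Critical (suc D) r t₀ T
        from-side (inj₁ quiet₁) = continue false quiet₁
        from-side (inj₂ quiet₁) = continue true quiet₁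

      record Pebbled (d : ℕ) : Set where
        field
          τ               : ℕ
          current         : Path
          current-depth   : length current ≡ d
          current-queried : QueriesAt V τ (heap current)
          pebbles         : List ℕ
          pebbles-unique  : Unique pebbles
          pebbles-count   : length pebbles ≡ suc (suc d)
          pebbles-in-tree : All InTree pebbles
          pebbles-pending : All (Pending V τ) pebbles

      pebbled : ∀ d → suc (suc d) ≤ h → Pebbled d
      pebbled d d+2≤h with root-queried V
      ... | T , _ , _ , root-at-T = record
        { τ = τ ; current = current ; current-depth = current-depth ; current-queried = current-queried
        ; pebbles = map heap pebbles
        ; pebbles-unique = Unique-map⁺ (heap-injective _ _) pebbles-unique
        ; pebbles-count = trans (length-map heap pebbles) pebbles-count
        ; pebbles-in-tree = All-map⁺ (all-map in-tree pebbles-below)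
        ; pebbles-pending = All-map⁺ pebbles-pending }
        where
        shallow : suc d ≤ h ∸ 1
        shallow = ∸-monoˡ-≤ 1 d+2≤h
        quiet₀ : Quiet 0 (below (suc d) [])
        quiet₀ some = nothing-pending-initially V _ (proj₂ (proj₂ (find some)))
        open Critical (critical d [] {0} {T} shallow root-at-T z≤n quiet₀)
        in-tree : ∀ {q} → q ∈ below (suc d) [] → InTree (heap q)
        in-tree {q} q∈ with subtree-extends (suc d) [] (there q∈)
        ... | s , |s|≤ , q≡ = heap-positive q , heap-shallow q 0 (≤-trans (s≤s depth) d+2≤h)
          where
          depth : length q + 0 ≤ suc d
          depth = ≤-trans (≤-reflexive (trans (+-identityʳ _) (cong length (trans q≡ (++-identityʳ s))))) |s|≤

    module Replay (V : Labelling) (τ : ℕ) where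

      replay : ℕ → Config
      replay n = simulate (labelsOracle V) n (state V τ , memory (λ _ → nothing) [])

      step-tracks : ∀ t M → Accurate V M →
                    proj₁ (simulate-step (labelsOracle V) (state V t , M)) ≡ state V (suc t) ×
                    Accurate V (proj₂ (simulate-step (labelsOracle V) (state V t , M)))
      step-tracks t M acc with query (state V t) in eq
      ... | nothing = sym (step-final V _ eq) , acc
      ... | just q with consult-accurate V (target q) (prepare q M) (target-in-tree _ eq)
                          (prepare-accurate V q M (reveals-correct V t eq) acc)
      ...   | value , acc′ = trans (cong (next q) value) (sym (step-query V _ eq)) , acc′

      replay-tracks : ∀ n → ∃ λ M → replay n ≡ (state V (τ + n) , M) × Accurate V M
      replay-tracks zero = _ , cong (λ t → state V t , _) (sym (+-identityʳ τ)) ,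
                           record { sound = λ _ () ; read-unique = [] ; read-known = [] ; read-tree = [] }
      replay-tracks (suc n) with replay-tracks n
      ... | M , eq , acc rewrite eq with step-tracks (τ + n) M acc
      ...   | at-state , acc′ = _ , cong (_, proj₂ next-config) (trans at-state (cong (state V) (sym (+-suc τ n)))) , acc′
        where
        next-config : Config
        next-config = simulate-step (labelsOracle V) (state V (τ + n) , M)

      pebble-invariant : ∀ j t′ → τ ≤ t′ → Certifies V t′ j → NotQueriedIn V j τ t′ → ∀ n →
                         j ∉ read (proj₂ (replay n)) × (t′ < τ + n → Known (known (proj₂ (replay n))) j)
      pebble-invariant j t′ τ≤t′ cert not-queried zero =
        (λ ()) , λ t′<τ+0 → ⊥-elim (<⇒≱ t′<τ+0 (≤-trans (≤-reflexive (+-identityʳ τ)) τ≤t′))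
      pebble-invariant j t′ τ≤t′ cert not-queried (suc n)
        with pebble-invariant j t′ τ≤t′ cert not-queried n | replay-tracks n
      ... | unread , known-later | M , eq , _ rewrite eq = next-step
        where
        o : Oracle
        o = labelsOracle V
        earlier-or-now : t′ < τ + suc n → t′ < τ + n ⊎ t′ ≡ τ + n
        earlier-or-now t′< = m≤n⇒m<n∨m≡n (≤-pred (≤-trans t′< (≤-reflexive (+-suc τ n))))
        next-step : j ∉ read (proj₂ (simulate-step o (state V (τ + n) , M))) ×
                    (t′ < τ + suc n → Known (known (proj₂ (simulate-step o (state V (τ + n) , M)))) j)
        next-step with query (state V (τ + n)) in qeq
        ... | nothing = unread , λ t′< → case earlier-or-now t′< of λ
          { (inj₁ t′<τ+n) → known-later t′<τ+n
          ; (inj₂ refl)   → case trans (sym qeq) (proj₁ (proj₂ cert)) of λ () }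
        ... | just q = unread′ , λ t′< → consult-keeps o _ (prepare q M) (known′ (≤-pred (≤-trans t′< (≤-reflexive (+-suc τ n)))))
          where
          known′ : t′ ≤ τ + n → Known (known (prepare q M)) j
          known′ t′≤ with m≤n⇒m<n∨m≡n t′≤
          ... | inj₁ t′<τ+n = learnAll-keeps (reveals q) (known M) (known-later t′<τ+n)
          ... | inj₂ refl with trans (sym qeq) (proj₁ (proj₂ cert))
          ...   | refl = learnAll-learns (reveals q) (known M) (proj₂ (proj₂ cert))
          unread′ : j ∉ read (proj₂ (consult o (target q) (prepare q M)))
          unread′ j∈ with consult-reads o (target q) (prepare q M) j∈
          ... | inj₁ j∈M = unread j∈M
          ... | inj₂ (refl , unknown) with τ + n <? t′
          ...   | yes τ+n<t′ = not-queried τ+n<t′ (m≤m+n τ n) (q , qeq , refl)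
          ...   | no  τ+n≮t′ = case trans (sym (proj₂ (known′ (≮⇒≥ τ+n≮t′)))) unknown of λ ()

    -- Words of length N label the N tree nodes 1, …, N.
    N : ℕ
    N = 2 ^ h ∸ 1

    labels : Vec (Fin k) N → Labelling
    labels w zero    = fzero
    labels w (suc j) = at fzero w j

    treeNodes : List ℕ
    treeNodes = applyUpTo suc N

    treeNodes-in-tree : All InTree treeNodes
    treeNodes-in-tree = All-applyUpTo⁺ suc N λ i<N →
      s≤s z≤n , ≤-trans (s≤s i<N) (≤-reflexive (m+[n∸m]≡n {1} {2 ^ h} (m^n>0 2 h)))

    fuel : ℕ
    fuel = proj₁ (bounded-on-words (halt ∘ labels))

    wordOracle : ∀ {r} → Vec (Fin k) r → Oracle
    wordOracle e L _ = at fzero e (length L)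

    decodeMemory : Oracle → Fin size → Memory
    decodeMemory o s = fill o treeNodes (proj₂ (simulate o fuel (s , memory (λ _ → nothing) [])))

    decode : ∀ {r} → Fin size → Vec (Fin k) r → Vec (Fin k) N
    decode s e = tabulate λ i → fromMaybe fzero (known (decodeMemory (wordOracle e) s) (suc (toℕ i)))

    -- Since the d + 2 pebbles are never read, N ∸ (d + 2) letters suffice.
    module Encoding (d : ℕ) (d+2≤h : suc (suc d) ≤ h) (w : Vec (Fin k) N) where
      V : Labelling
      V = labels w
      open Pebbling V using (Pebbled; pebbled)
      open Pebbled (pebbled d d+2≤h) public
      open Replay V τ

      critical-state : Fin size
      critical-state = state V τ

      reads : List ℕ
      reads = read (decodeMemory (labelsOracle V) critical-state)

      encoding : Vec (Fin k) (N ∸ suc (suc d))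
      encoding = pad fzero _ (map V reads)

      replayed : ∃ λ M → replay fuel ≡ (state V (τ + fuel) , M) × Accurate V M
      replayed = replay-tracks fuel

      halted-by-fuel : halt V ≤ τ + fuel
      halted-by-fuel = ≤-trans (proj₂ (bounded-on-words (halt ∘ labels)) w) (m≤n+m fuel τ)

      accurate : Accurate V (decodeMemory (labelsOracle V) critical-state)
      accurate rewrite proj₁ (proj₂ replayed) = fill-accurate V treeNodes _ treeNodes-in-tree (proj₂ (proj₂ replayed))

      pebbles-unread : ∀ {j} → j ∈ pebbles → j ∉ reads
      pebbles-unread j∈ with all-lookup pebbles-pending j∈
      ... | t′ , t′<H , τ≤t′ , cert , not-queried with pebble-invariant _ t′ τ≤t′ cert not-queried fuel
      ...   | unread , known-later = fill-unread (labelsOracle V) treeNodes _ (known-later (≤-trans t′<H halted-by-fuel)) unread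

      reads-short : length reads ≤ N ∸ suc (suc d)
      reads-short = m+n≤o⇒m≤o∸n (length reads) (begin
          length reads + suc (suc d)   ≡⟨ cong (length reads +_) (sym pebbles-count) ⟩
          length reads + length pebbles ≡⟨ sym (length-++ reads) ⟩
          length (reads ++ pebbles)     ≤⟨ unique-bounded (reads ++ pebbles)
                                             (Unique-++⁺ (Accurate.read-unique accurate) pebbles-unique
                                                         λ (j∈reads , j∈pebbles) → pebbles-unread j∈pebbles j∈reads)
                                             (++⁺ (Accurate.read-tree accurate) pebbles-in-tree) ⟩
          N                             ∎)
        where open ≤-Reasoning

      interchangeable : Interchangeable (labelsOracle V) (wordOracle encoding) reads
      interchangeable L j (r , reads≡) = sym (begin
          at fzero encoding (length L)
            ≡⟨ cong (λ xs → at fzero (pad fzero (N ∸ suc (suc d)) (map V xs)) (length L)) (trans reads≡ (++-assoc L (j ∷ []) r)) ⟩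
          at fzero (pad fzero (N ∸ suc (suc d)) (map V (L ++ j ∷ r))) (length L)
            ≡⟨ cong₂ (λ xs i → at fzero (pad fzero (N ∸ suc (suc d)) xs) i) (map-++ V L (j ∷ r)) (sym (length-map V L)) ⟩
          at fzero (pad fzero (N ∸ suc (suc d)) (map V L ++ V j ∷ map V r)) (length (map V L))
            ≡⟨ at-pad fzero (N ∸ suc (suc d)) (map V L) (V j) (map V r) (≤-trans (s≤s (≤-reflexive (length-map V L))) (≤-trans (read-before (r , reads≡)) reads-short)) ⟩
          V j ∎)
        where
        open ≡-Reasoning

      same-memory : decodeMemory (wordOracle encoding) critical-state ≡ decodeMemory (labelsOracle V) critical-state
      same-memory = sym (trans (fill-agree interchangeable treeNodes _ (≼-refl reads))
                               (cong (fill (wordOracle encoding) treeNodes ∘ proj₂) replay-agrees))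
        where
        replay-agrees : replay fuel ≡ simulate (wordOracle encoding) fuel (critical-state , memory (λ _ → nothing) [])
        replay-agrees = simulate-agree interchangeable fuel _ (fill-grows _ treeNodes _)

      decodes : decode critical-state encoding ≡ w
      decodes = begin
          decode critical-state encoding
            ≡⟨ cong (λ M → tabulate λ i → fromMaybe fzero (known M (suc (toℕ i)))) same-memory ⟩
          tabulate (λ i → fromMaybe fzero (known (decodeMemory (labelsOracle V) critical-state) (suc (toℕ i))))
            ≡⟨ tabulate-cong entry ⟩
          tabulate (vlookup w)
            ≡⟨ tabulate∘lookup w ⟩
          w ∎
        where
        open ≡-Reasoning
        entry : ∀ i → fromMaybe fzero (known (decodeMemory (labelsOracle V) critical-state) (suc (toℕ i))) ≡ vlookup w i
        entry i with fill-knows (labelsOracle V) treeNodes (proj₂ (replay fuel)) (∈-applyUpTo⁺ suc (toℕ<n i))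
        ... | v , e rewrite e = trans (sym (Accurate.sound accurate _ e)) (at-lookup fzero w i)

    level-bound : ∀ d → suc (suc d) ≤ h →
                  k ^ suc (suc d) ≤ length (filter (λ s → level s ≟ suc (suc d)) (allFin size))
    level-bound d d+2≤h = *-cancelʳ-≤ (k ^ m) (length class) (k ^ (N ∸ m)) {{m^n≢0 k (N ∸ m)}} (begin
        k ^ m * k ^ (N ∸ m)       ≡⟨ sym (^-distribˡ-+-* k m (N ∸ m)) ⟩
        k ^ (m + (N ∸ m))         ≡⟨ cong (k ^_) (m+[n∸m]≡n (≤-trans d+2≤h h≤N)) ⟩
        k ^ N                     ≤⟨ encoding-bound class E.critical-state E.encoding decode in-class E.decodes ⟩
        length class * k ^ (N ∸ m) ∎)
      where
      open ≤-Reasoning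
      m : ℕ
      m = suc (suc d)
      class : List (Fin size)
      class = filter (λ s → level s ≟ m) (allFin size)
      module E w = Encoding d d+2≤h w
      in-class : ∀ w → E.critical-state w ∈ class
      in-class w = ∈-filter⁺ (λ s → level s ≟ m) (∈-allFin _)
        (trans (level-queried (E.V w) (E.τ w) (E.current w) (E.current-queried w)) (cong (2 +_) (E.current-depth w)))
      n<2^n : ∀ n → n < 2 ^ n
      n<2^n zero    = s≤s z≤n
      n<2^n (suc n) = ≤-trans (+-mono-≤ (m^n>0 2 n) (n<2^n n)) (≤-reflexive (cong (2 ^ n +_) (sym (+-identityʳ (2 ^ n)))))
      h≤N : h ≤ N
      h≤N = m+n≤o⇒m≤o∸n h (≤-trans (≤-reflexive (+-comm h 1)) (n<2^n h))

corollary5p11 : ∀ (h k : ℕ) → 2 ≤ h → 2 ≤ k →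
    (P : BP (Var h k) k) → Computes P (BT h k) → Thrifty h k P →
    powSum k h ≤ BP.size P
corollary5p11 h (suc (suc k′)) 2≤h (s≤s (s≤s _)) P computes thrifty = begin
    powSum k h                ≡⟨ powSum≡Σ₂ k h ⟩
    Σ₂ (k ^_) h               ≤⟨ Σ₂-mono _ _ h level-bound′ ⟩
    Σ₂ (λ l → length (filter (λ s → level s ≟ l) (allFin size))) h
                              ≤⟨ level-classes level h (allFin size) ⟩
    length (allFin size)      ≡⟨ length-tabulate id ⟩
    size                      ∎
  where
  open ≤-Reasoning
  open Runs h k′ P
  open BP P using (size)
  open ThriftySolver thrifty computes (≤-trans (s≤s z≤n) 2≤h)
  level-bound′ : ∀ l → 2 ≤ l → l ≤ h → k ^ l ≤ length (filter (λ s → level s ≟ l) (allFin size))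
  level-bound′ (suc (suc d)) (s≤s (s≤s _)) l≤h = level-bound d l≤h
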